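{- Let $N,D\in\mathbb{N}$ with $D\mid N$, let $\mathcal{T}$ be an $N$-regular rooted tree equipped with a regular $D$-coloring, and let $\mathcal{S}\subset\mathcal{T}$ be a subtree. Suppose that for every subtree $\mathcal{R}\subset\mathcal{T}$ of type (II), the set $\mathcal{S}\cap\mathcal{R}$ is infinite. Then $\mathcal{S}$ contains a subtree of type (I).
   Context: A rooted tree is identified with its set of vertices; $\mathcal{T}_n$ is the set of vertices of level $n$ (the root has level $0$), and $\mathcal{T}_{\mathrm{suc}}(\tau)$ is the set of successors (children) of $\tau$. A subtree of $\mathcal{T}$ is a rooted subtree containing the root of $\mathcal{T}$ (with the same root). $\mathcal{T}$ is $N$-regular if $\#\mathcal{T}_{\mathrm{suc}}(\tau)=N$ for all $\tau$. A $D$-coloring is a map $\gamma:\mathcal{T}\to\{1,\dots,D\}$; for $\mathcal{V}\subset\mathcal{T}$ write $\mathcal{V}^{(i)}=\mathcal{V}\cap\gamma^{ -1}(i)$. The coloring is regular if $\#\mathcal{T}_{\mathrm{suc}}(\tau)^{(i)}=N/D$ for all $\tau\in\mathcal{T}$ and $1\le i\le D$. A subtree $\mathcal{S}\subset\mathcal{T}$ is of type (I) if $\#\mathcal{S}_{\mathrm{suc}}(\tau)^{(i)}=1$ for all $\tau\in\mathcal{S}$ and $1\le i\le D$ (where $\mathcal{S}_{\mathrm{suc}}(\tau)$ is the set of successors of $\tau$ in $\mathcal{S}$); it is of type (II) if for every $\tau\in\mathcal{S}$ there is $i(\tau)\in\{1,\dots,D\}$ with $\mathcal{S}_{\mathrm{suc}}(\tau)=\mathcal{T}_{\mathrm{suc}}(\tau)^{(i(\tau))}$.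 -}

module Defs where

open import Data.Nat using (ℕ; NonZero)
open import Data.Nat.DivMod using (_/_)
open import Data.Fin using (Fin; _≟_)
open import Data.List using (List; []; _∷_; length; filter; allFin)
open import Data.List.Membership.Propositional using (_∈_)
open import Data.Product using (Σ; _×_; ∃-syntax)
open import Relation.Nullary using (¬_)
open import Relation.Binary.PropositionalEquality using (_≡_)

-- The N-regular rooted tree: vertices are finite words over Fin N.
-- A vertex is written as the path read from the vertex back to the root,
-- so the root is [] and the children of τ are (j ∷ τ) for j : Fin N.
Vertex : ℕ → Set
Vertex N = List (Fin N)

VSet : ℕ → Set₁
VSet N = Vertex N → Set

-- A D-coloring (colors {1..D} rendered as Fin D)
Coloring : ℕ → ℕ → Set
Coloring N D = Vertex N → Fin D

Regular : (N D : ℕ) → .{{_ : NonZero D}} → Coloring N D → Set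
Regular N D γ =
  (τ : Vertex N) (c : Fin D) →
  length (filter (λ j → γ (j ∷ τ) ≟ c) (allFin N)) ≡ N / D

IsSubtree : {N : ℕ} → VSet N → Set
IsSubtree {N} S = S [] × ((j : Fin N) (τ : Vertex N) → S (j ∷ τ) → S τ)

TypeI : {N D : ℕ} → Coloring N D → VSet N → Set
TypeI {N} {D} γ R =
  IsSubtree R ×
  ((τ : Vertex N) → R τ → (c : Fin D) →
     Σ (Fin N) λ j → R (j ∷ τ) × γ (j ∷ τ) ≡ c ×
       ((k : Fin N) → R (k ∷ τ) → γ (k ∷ τ) ≡ c → k ≡ j))

TypeII : {N D : ℕ} → Coloring N D → VSet N → Set
TypeII {N} {D} γ R =
  IsSubtree R ×
  ((τ : Vertex N) → R τ →
     Σ (Fin D) λ i → (j : Fin N) →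
       (R (j ∷ τ) → γ (j ∷ τ) ≡ i) × (γ (j ∷ τ) ≡ i → R (j ∷ τ)))

_∩_ : {N : ℕ} → VSet N → VSet N → VSet N
(S ∩ R) τ = S τ × R τ

_⊆_ : {N : ℕ} → VSet N → VSet N → Set
S ⊆ R = ∀ τ → S τ → R τ

Finite : {N : ℕ} → VSet N → Set
Finite {N} S = Σ (List (Vertex N)) λ l → (τ : Vertex N) → S τ → τ ∈ l

Infinite : {N : ℕ} → VSet N → Set
Infinite S = ¬ Finite S

{-# OPTIONS --safe #-}
-- Call a vertex τ good if S meets every type (II) tree grown from τ in an infinite set.
-- If τ is good then, for every colour c, some child of colour c is good: otherwise each
-- child of colour c has a type (II) tree meeting S finitely, and grafting these trees
-- below τ gives a type (II) tree from τ meeting S finitely.  The hypothesis says the root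
-- is good, so choosing one good child of each colour at every chosen vertex yields a
-- type (I) subtree of good vertices, and good vertices lie in S.
module Submission where

open import Defs
open import Level using (0ℓ)
open import Axiom.ExcludedMiddle using (ExcludedMiddle)
open import Axiom.DoubleNegationElimination using (em⇒dne)
open import Data.Nat using (ℕ; NonZero; _≤_)
open import Data.Nat.Properties using (≤-refl; m≤n⇒m≤1+n; 1+n≰n)
open import Data.Nat.Divisibility using (_∣_)
open import Data.Fin using (Fin; _≟_)
open import Data.Maybe using (Maybe; just; nothing)
open import Data.Maybe.Properties using (just-injective)
open import Data.Product using (Σ; _×_; _,_; proj₁; proj₂)
open import Data.Sum using (_⊎_; inj₁; inj₂)
open import Data.Unit using (⊤; tt)
open import Data.Empty using (⊥-elim)
open import Data.List using (List; []; _∷_; length; concatMap; allFin)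
open import Data.List.Membership.Propositional using (_∈_)
open import Data.List.Membership.Propositional.Properties using (∈-concatMap⁺; ∈-allFin)
open import Data.List.Relation.Unary.Any using (here; there)
import Data.List.Relation.Unary.Any as Any
open import Relation.Nullary using (Dec; yes; no; ¬_)
open import Relation.Binary.PropositionalEquality using (_≡_; refl; sym; trans; cong)

module _ {A : Set} {P : A → Set} where

  witness : Dec (Σ A P) → Maybe A
  witness (yes (a , _)) = just a
  witness (no _)        = nothing

  witness-sound : (d : Dec (Σ A P)) {a : A} → witness d ≡ just a → P a
  witness-sound (yes (a , p)) refl = p

  witness-complete : (d : Dec (Σ A P)) → Σ A P → Σ A λ a → witness d ≡ just a × P a
  witness-complete (yes (a , p)) _ = a , refl , p
  witness-complete (no ¬q)       q = ⊥-elim (¬q q)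

module _ {N : ℕ} where

  Finite-⊆ : {A B : VSet N} → A ⊆ B → Finite B → Finite A
  Finite-⊆ A⊆B (l , B⊆l) = l , λ σ a → B⊆l σ (A⊆B σ a)

  Finite-insert : (τ : Vertex N) {A : VSet N} → Finite A → Finite (λ σ → σ ≡ τ ⊎ A σ)
  Finite-insert τ (l , A⊆l) = τ ∷ l , λ where
    _ (inj₁ refl) → here refl
    σ (inj₂ a)    → there (A⊆l σ a)

  Finite-⋃ : {n : ℕ} (A : Fin n → VSet N) → ((j : Fin n) → Finite (A j)) →
             Finite (λ σ → Σ (Fin n) λ j → A j σ)
  Finite-⋃ {n} A fin = concatMap (λ j → proj₁ (fin j)) (allFin n) , covers
    where
    covers : (σ : Vertex N) → Σ (Fin n) (λ j → A j σ) → σ ∈ concatMap (λ j → proj₁ (fin j)) (allFin n)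
    covers σ (j , a) = ∈-concatMap⁺ _ (Any.map (λ { refl → proj₂ (fin j) σ a }) (∈-allFin j))

module Colored {N D : ℕ} (γ : Coloring N D) where

  Choice : Set
  Choice = Vertex N → Fin D

  data Reach (i : Choice) (τ : Vertex N) : VSet N where
    root : Reach i τ τ
    step : ∀ {σ} j → Reach i τ σ → γ (j ∷ σ) ≡ i σ → Reach i τ (j ∷ σ)

  Reach-length : ∀ {i τ σ} → Reach i τ σ → length τ ≤ length σ
  Reach-length root         = ≤-refl
  Reach-length (step _ r _) = m≤n⇒m≤1+n (Reach-length r)

  Reach-∌-parent : ∀ {i j τ} → ¬ Reach i (j ∷ τ) τ
  Reach-∌-parent r = 1+n≰n (Reach-length r)

  Reach-TypeII : (i : Choice) → TypeII γ (Reach i [])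
  Reach-TypeII i = (root , parent) , λ τ r → i τ , λ j → (λ { (step _ _ e) → e }) , step j r
    where
    parent : (j : Fin N) (τ : Vertex N) → Reach i [] (j ∷ τ) → Reach i [] τ
    parent _ _ (step _ r _) = r

  Reach-ancestor : {S : VSet N} → IsSubtree S → ∀ {i τ σ} → Reach i τ σ → S σ → S τ
  Reach-ancestor S-sub root         s = s
  Reach-ancestor S-sub (step j r _) s = Reach-ancestor S-sub r (proj₂ S-sub j _ s)

  module Graft (em : ExcludedMiddle 0ℓ) (τ : Vertex N) (c : Fin D) (I : Fin N → Choice) where

    Grafted : VSet N
    Grafted σ = Σ (Fin N) λ j → γ (j ∷ τ) ≡ c × Reach (I j) (j ∷ τ) σ

    choose : (σ : Vertex N) → Dec (Grafted σ) → Fin D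
    choose σ (yes (j , _)) = I j σ
    choose σ (no _)        = c

    grafted : Choice
    grafted σ = choose σ em

    grafted-root : (d : Dec (Grafted τ)) → choose τ d ≡ c
    grafted-root (yes (_ , _ , r)) = ⊥-elim (Reach-∌-parent r)
    grafted-root (no _)            = refl

    Grafted-step : ∀ {σ k} (d : Dec (Grafted σ)) → Grafted σ → γ (k ∷ σ) ≡ choose σ d → Grafted (k ∷ σ)
    Grafted-step (yes (j , e , r)) _ eₖ = j , e , step _ r eₖ
    Grafted-step (no ¬g)           g _  = ⊥-elim (¬g g)

    Reach-grafted : Reach grafted τ ⊆ (λ σ → σ ≡ τ ⊎ Grafted σ)
    Reach-grafted _ root = inj₁ refl
    Reach-grafted _ (step k r e) with Reach-grafted _ r
    ... | inj₁ refl = inj₂ (k , trans e (grafted-root em) , root)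
    ... | inj₂ g    = inj₂ (Grafted-step em g e)

module Construction (em : ExcludedMiddle 0ℓ) {N D : ℕ} (γ : Coloring N D)
                    (S : VSet N) (S-sub : IsSubtree S) where

  open Colored γ

  dne : {P : Set} → ¬ ¬ P → P
  dne = em⇒dne em

  Good : Vertex N → Set
  Good τ = (i : Choice) → Infinite (S ∩ Reach i τ)

  Good⇒S : ∀ {τ} → Good τ → S τ
  Good⇒S {τ} good = dne λ ¬s →
    good (λ _ → γ τ) ([] , λ { σ (s , r) → ⊥-elim (¬s (Reach-ancestor S-sub r s)) })

  ¬Good⇒finite : ∀ {τ} → ¬ Good τ → Σ Choice λ i → Finite (S ∩ Reach i τ)
  ¬Good⇒finite ¬good = dne λ ¬fin → ¬good λ i fin → ¬fin (i , fin)

  GoodChild : Vertex N → Fin D → Fin N → Set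
  GoodChild τ c j = γ (j ∷ τ) ≡ c × Good (j ∷ τ)

  no-good-child⇒¬Good : ∀ {τ} (c : Fin D) → ¬ Σ (Fin N) (GoodChild τ c) → ¬ Good τ
  no-good-child⇒¬Good {τ} c ¬child good =
    good grafted (Finite-⊆ classify (Finite-insert τ (Finite-⋃ Escaped (λ j → proj₂ (escape j)))))
    where
    BelowChild : Fin N → Choice → VSet N
    BelowChild j i σ = γ (j ∷ τ) ≡ c × (S ∩ Reach i (j ∷ τ)) σ

    escape : (j : Fin N) → Σ Choice λ i → Finite (BelowChild j i)
    escape j with γ (j ∷ τ) ≟ c
    ... | yes e = let (i , l , cover) = ¬Good⇒finite (λ g → ¬child (j , e , g))
                  in i , l , λ σ (_ , x) → cover σ x
    ... | no ¬e = (λ _ → c) , [] , λ σ (e , _) → ⊥-elim (¬e e)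

    Escaped : Fin N → VSet N
    Escaped j = BelowChild j (proj₁ (escape j))

    open Graft em τ c (λ j → proj₁ (escape j))

    classify : (S ∩ Reach grafted τ) ⊆ (λ σ → σ ≡ τ ⊎ Σ (Fin N) λ j → Escaped j σ)
    classify σ (s , r) with Reach-grafted σ r
    ... | inj₁ σ≡τ          = inj₁ σ≡τ
    ... | inj₂ (j , e , r′) = inj₂ (j , e , s , r′)

  good-child : ∀ {τ} → Good τ → (c : Fin D) → Σ (Fin N) (GoodChild τ c)
  good-child good c = dne λ ¬child → no-good-child⇒¬Good c ¬child good

  good-child? : (τ : Vertex N) (c : Fin D) → Dec (Σ (Fin N) (GoodChild τ c))
  good-child? τ c = em

  chosen : Vertex N → Fin D → Maybe (Fin N)
  chosen τ c = witness (good-child? τ c)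

  Chosen : VSet N
  Chosen []      = ⊤
  Chosen (j ∷ τ) = Chosen τ × chosen τ (γ (j ∷ τ)) ≡ just j

  module _ (root-good : Good []) where

    Chosen⇒Good : ∀ τ → Chosen τ → Good τ
    Chosen⇒Good []      _       = root-good
    Chosen⇒Good (j ∷ τ) (_ , e) = proj₂ (witness-sound (good-child? τ _) e)

    Chosen-TypeI : TypeI γ Chosen
    Chosen-TypeI = (tt , λ _ _ → proj₁) , children
      where
      children : (τ : Vertex N) → Chosen τ → (c : Fin D) →
                 Σ (Fin N) λ j → Chosen (j ∷ τ) × γ (j ∷ τ) ≡ c ×
                   ((k : Fin N) → Chosen (k ∷ τ) → γ (k ∷ τ) ≡ c → k ≡ j)
      children τ r c with witness-complete (good-child? τ c) (good-child (Chosen⇒Good τ r) c)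
      ... | j , e , γj≡c , _ =
        j , (r , trans (cong (chosen τ) γj≡c) e) , γj≡c ,
        λ k (_ , eₖ) γk≡c → just-injective (trans (sym eₖ) (trans (cong (chosen τ) γk≡c) e))

    Chosen⊆S : Chosen ⊆ S
    Chosen⊆S τ r = Good⇒S (Chosen⇒Good τ r)

  root-good : ((R : VSet N) → TypeII γ R → Infinite (S ∩ R)) → Good []
  root-good hyp i = hyp (Reach i []) (Reach-TypeII i)

proposition2p2 : ExcludedMiddle 0ℓ →
    (N D : ℕ) → .{{_ : NonZero D}} → D ∣ N →
    (γ : Coloring N D) → Regular N D γ →
    (S : VSet N) → IsSubtree S →
    ((R : VSet N) → TypeII γ R → Infinite (S ∩ R)) →
    Σ (VSet N) λ R → TypeI γ R × (R ⊆ S)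
proposition2p2 em N D _ γ _ S S-sub hyp =
  Chosen , Chosen-TypeI (root-good hyp) , Chosen⊆S (root-good hyp)
  where open Construction em γ S S-sub
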